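{- Let $G$ be a graph on $n$ vertices with maximum degree $\Delta(G)$, clique number $\omega=\omega(G)$, chromatic number $\chi(G)$ and independence number $\alpha(G)$. Then: (1) $\frac{\Delta(G)}{\omega-1}+\chi(G)\le n+1$, and equality holds if and only if $G$ is the complete graph $K_n$ or the star $K_{1,n-1}$; (2) $\alpha(G)+\chi(G)\leq n+1$, and equality holds if and only if there exists a vertex $v\in V(G)$ such that its open neighborhood $N(v)$ induces a complete graph and $V(G)\setminus N(v)$ is an independent set.
   Context: All graphs are finite, simple and undirected; $N(v)$ is the set of neighbors of $v$. -}

module Defs where

open import Data.Nat using (ℕ; _≤_; _⊔_)
open import Data.Fin using (Fin)
open import Data.Bool using (Bool; true; false)
open import Data.List using (List; length; filterᵇ; allFin; map; foldr)
open import Data.Product using (Σ; _×_; ∃)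
open import Data.Sum using (_⊎_)
open import Relation.Binary.PropositionalEquality using (_≡_; _≢_)
open import Function.Definitions using (Injective)

record Graph (n : ℕ) : Set where
  field
    adj    : Fin n → Fin n → Bool
    sym    : ∀ u v → adj u v ≡ adj v u
    irrefl : ∀ v → adj v v ≡ false
open Graph public

degree : ∀ {n} → Graph n → Fin n → ℕ
degree {n} G v = length (filterᵇ (adj G v) (allFin n))

-- maximum degree Δ(G) (0 for the empty graph)
maxDegree : ∀ {n} → Graph n → ℕ
maxDegree {n} G = foldr _⊔_ 0 (map (degree G) (allFin n))

IsClique : ∀ {n} → Graph n → (k : ℕ) → (Fin k → Fin n) → Set
IsClique G k f = Injective _≡_ _≡_ f × (∀ i j → i ≢ j → adj G (f i) (f j) ≡ true)

IsIndependent : ∀ {n} → Graph n → (k : ℕ) → (Fin k → Fin n) → Set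
IsIndependent G k f = Injective _≡_ _≡_ f × (∀ i j → adj G (f i) (f j) ≡ false)

IsCliqueNumber : ∀ {n} → Graph n → ℕ → Set
IsCliqueNumber G ω =
  Σ (Fin ω → _) (IsClique G ω) × (∀ k (f : Fin k → _) → IsClique G k f → k ≤ ω)

IsIndependenceNumber : ∀ {n} → Graph n → ℕ → Set
IsIndependenceNumber G α =
  Σ (Fin α → _) (IsIndependent G α) × (∀ k (f : Fin k → _) → IsIndependent G k f → k ≤ α)

IsProperColouring : ∀ {n} → Graph n → (k : ℕ) → (Fin n → Fin k) → Set
IsProperColouring G k c = ∀ u v → adj G u v ≡ true → c u ≢ c v

IsChromaticNumber : ∀ {n} → Graph n → ℕ → Set
IsChromaticNumber {n} G χ =
  Σ (Fin n → Fin χ) (IsProperColouring G χ) × (∀ k (c : Fin n → Fin k) → IsProperColouring G k c → χ ≤ k)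

IsComplete : ∀ {n} → Graph n → Set
IsComplete {n} G = ∀ (u v : Fin n) → u ≢ v → adj G u v ≡ true

-- G is (isomorphic to) the star K_{1,n-1}: some centre c such that the
-- edges are exactly the pairs containing c
IsStar : ∀ {n} → Graph n → Set
IsStar {n} G = ∃ λ (c : Fin n) → ∀ (u v : Fin n) → u ≢ v → (adj G u v ≡ true → (u ≡ c ⊎ v ≡ c)) × ((u ≡ c ⊎ v ≡ c) → adj G u v ≡ true)

NeighbourhoodComplete : ∀ {n} → Graph n → Fin n → Set
NeighbourhoodComplete {n} G v =
  ∀ (u w : Fin n) → adj G v u ≡ true → adj G v w ≡ true → u ≢ w → adj G u w ≡ true

ComplementOfNeighbourhoodIndependent : ∀ {n} → Graph n → Fin n → Set
ComplementOfNeighbourhoodIndependent {n} G v =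
  ∀ (u w : Fin n) → adj G v u ≡ false → adj G v w ≡ false → adj G u w ≡ false

-- Colour a maximum independent set I with one colour and every other vertex with a colour of its
-- own: χ ≤ n - α + 1. When this is tight, V \ I is a clique (two non-adjacent vertices there could share a
-- colour) and some vertex of I sees all of V \ I (otherwise every vertex of I could take the colour of a
-- non-neighbour outside I); that vertex is the required v. Conversely, for such a v the sets N[v] and
-- V \ N(v) are a clique and an independent set with n + 1 vertices in total.
--
-- If ω = 2, the neighbourhood of a vertex of maximum degree is independent, so as above
-- χ ≤ n - Δ + 1, with equality only if that vertex is adjacent to all others, i.e. G is a star. If ω ≥ 3,
-- the bound follows from Δ ≤ n - 1 and 2χ ≤ n + ω: in an optimal colouring the singleton classes span a
-- clique and every other class has at least two vertices. Equality forces 2χ = n + ω, and then every class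
-- is a singleton (a two-vertex class could be dissolved into singleton classes its vertices do not see),
-- so G = K_n.

module Submission where

open import Defs renaming (sym to adj-sym)
open import Data.Bool using (Bool; true; false; not; if_then_else_)
open import Data.Bool.Properties using (T-≡; not-injective; ¬-not)
import Data.Bool.Properties as Bool
open import Data.Empty using (⊥; ⊥-elim)
open import Data.Fin as Fin using (Fin; zero; suc; punchOut)
open import Data.Fin.Properties using (injective⇒≤; punchOut-injective)
import Data.Fin.Properties as Fin
open import Data.Vec.Functional using (updateAt)
open import Data.Vec.Functional.Properties using (updateAt-updates; updateAt-minimal)
open import Data.List using (List; []; _∷_; length; filterᵇ; allFin; lookup; map; foldr; _++_)
open import Data.List.Membership.Propositional using (_∈_; _∉_)
open import Data.List.Membership.Propositional.Properties
  using (∈-allFin; ∈-lookup; ∈-filter⁺; ∈-filter⁻; ∈-map⁻; ∈-++⁻; foldr-selective)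
open import Data.List.Properties using (length-map; length-++; length-tabulate)
open import Data.List.Relation.Binary.Subset.Propositional using (_⊆_)
import Data.List.Relation.Unary.All as All
open import Data.List.Relation.Unary.AllPairs using ([]; _∷_)
open import Data.List.Relation.Unary.Any using (here; there; index; any?)
open import Data.List.Relation.Unary.Any.Properties using (lookup-index)
open import Data.List.Relation.Unary.Unique.Propositional using (Unique)
import Data.List.Relation.Unary.Unique.Propositional.Properties as Unique
open import Data.Nat using (ℕ; zero; suc; _+_; _*_; _∸_; _≤_; _<_; _⊔_; z≤n; s≤s)
open import Data.Nat.Properties
open import Data.Nat.Tactic.RingSolver using (solve)
open import Data.Product using (_×_; _,_; proj₁; proj₂; ∃)
open import Data.Sum using (_⊎_; inj₁; inj₂; [_,_]′)
open import Function using (_∘_; id; const; Injective)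
open import Function.Bundles using (_⇔_; mk⇔; Equivalence)
open import Relation.Binary.PropositionalEquality
open import Relation.Nullary using (¬_; yes; no; Dec; contradiction; isYes)
open import Relation.Nullary.Decidable using (T?; ¬?; _×-dec_; _→-dec_)

private
  variable
    A : Set
    n : ℕ

true≢false : true ≢ false
true≢false ()

lookup-injective : {xs : List A} → Unique xs → Injective _≡_ _≡_ (lookup xs)
lookup-injective (_ ∷ _) {zero} {zero} _ = refl
lookup-injective (x∉xs ∷ _) {zero} {suc j} e = contradiction e (All.lookup x∉xs (∈-lookup j))
lookup-injective (x∉xs ∷ _) {suc i} {zero} e = contradiction (sym e) (All.lookup x∉xs (∈-lookup i))
lookup-injective (_ ∷ u) {suc i} {suc j} e = cong suc (lookup-injective u e)

Unique-∷⁺ : {x : A} {xs : List A} → x ∉ xs → Unique xs → Unique (x ∷ xs)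
Unique-∷⁺ {xs = xs} x∉xs u = All.tabulate (λ y∈xs x≡y → x∉xs (subst (_∈ xs) (sym x≡y) y∈xs)) ∷ u

Unique-⊆⇒length≤ : {xs ys : List A} → Unique xs → xs ⊆ ys → length xs ≤ length ys
Unique-⊆⇒length≤ {xs = xs} {ys} u xs⊆ys = injective⇒≤ position-injective
  where
  position : Fin (length xs) → Fin (length ys)
  position i = index (xs⊆ys (∈-lookup i))
  position-injective : Injective _≡_ _≡_ position
  position-injective {i} {j} e = lookup-injective u (begin
    lookup xs i                ≡⟨ lookup-index (xs⊆ys (∈-lookup i)) ⟩
    lookup ys (position i)     ≡⟨ cong (lookup ys) e ⟩
    lookup ys (position j)     ≡⟨ lookup-index (xs⊆ys (∈-lookup j)) ⟨
    lookup xs j                ∎)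
    where open ≡-Reasoning

length-allFin : ∀ n → length (allFin n) ≡ n
length-allFin n = length-tabulate (λ i → i)

Unique⇒length≤ : {xs : List (Fin n)} → Unique xs → length xs ≤ n
Unique⇒length≤ {n} {xs} u =
  subst (length xs ≤_) (length-allFin n) (Unique-⊆⇒length≤ u (λ {x} _ → ∈-allFin x))

Unique-length≡⇒∈ : {xs : List (Fin n)} → Unique xs → length xs ≡ n → ∀ x → x ∈ xs
Unique-length≡⇒∈ {xs = xs} u |xs|≡n x with any? (x Fin.≟_) xs
... | yes x∈xs = x∈xs
... | no x∉xs =
  contradiction (subst (λ m → suc m ≤ _) |xs|≡n (Unique⇒length≤ (Unique-∷⁺ x∉xs u))) 1+n≰n

injective⇒surjective : {f : Fin n → Fin n} → Injective _≡_ _≡_ f → ∀ u → ∃ λ i → f i ≡ u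
injective⇒surjective {n} {f} f-injective u =
  let i , _ , u≡fi = ∈-map⁻ f (Unique-length≡⇒∈ (Unique.map⁺ f-injective (Unique.allFin⁺ n)) length≡n u)
  in i , sym u≡fi
  where
  length≡n : length (map f (allFin n)) ≡ n
  length≡n = trans (length-map f (allFin n)) (length-allFin n)

+-≤-≡⇒≡ : ∀ {a b m o} → a ≤ m → b ≤ o → a + b ≡ m + o → a ≡ m × b ≡ o
+-≤-≡⇒≡ {a} {b} {m} {o} a≤m b≤o a+b≡m+o = ≤-antisym a≤m m≤a , ≤-antisym b≤o o≤b
  where
  m≤a : m ≤ a
  m≤a = +-cancelʳ-≤ b m a (≤-trans (+-monoʳ-≤ m b≤o) (≤-reflexive (sym a+b≡m+o)))
  o≤b : o ≤ b
  o≤b = +-cancelˡ-≤ a o b (≤-trans (+-monoˡ-≤ o a≤m) (≤-reflexive (sym a+b≡m+o)))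

length-filterᵇ-partition : ∀ (p : A → Bool) xs →
  length (filterᵇ p xs) + length (filterᵇ (not ∘ p) xs) ≡ length xs
length-filterᵇ-partition p [] = refl
length-filterᵇ-partition p (x ∷ xs) with p x
... | true = cong suc (length-filterᵇ-partition p xs)
... | false = trans (+-suc _ _) (cong suc (length-filterᵇ-partition p xs))

≤-foldr-⊔ : ∀ (f : A → ℕ) {x xs} → x ∈ xs → f x ≤ foldr _⊔_ 0 (map f xs)
≤-foldr-⊔ f {xs = y ∷ _} (here refl) = m≤m⊔n (f y) _
≤-foldr-⊔ f {xs = y ∷ _} (there x∈xs) = ≤-trans (≤-foldr-⊔ f x∈xs) (m≤n⊔m (f y) _)

elements : (Fin n → Bool) → List (Fin n)
elements {n} p = filterᵇ p (allFin n)

module _ {p : Fin n → Bool} where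

  ∈-elements⁺ : ∀ {x} → p x ≡ true → x ∈ elements p
  ∈-elements⁺ {x} px = ∈-filter⁺ (T? ∘ p) (∈-allFin x) (Equivalence.from T-≡ px)

  ∈-elements⁻ : ∀ {x} → x ∈ elements p → p x ≡ true
  ∈-elements⁻ x∈ = Equivalence.to T-≡ (proj₂ (∈-filter⁻ (T? ∘ p) {xs = allFin n} x∈))

  Unique-elements : Unique (elements p)
  Unique-elements = Unique.filter⁺ (T? ∘ p) (Unique.allFin⁺ n)

  length-elements-partition : length (elements p) + length (elements (not ∘ p)) ≡ n
  length-elements-partition = trans (length-filterᵇ-partition p (allFin n)) (length-allFin n)

module _ {p : Fin n → Bool} where

  ∈-elements-not⁺ : ∀ {x} → p x ≡ false → x ∈ elements (not ∘ p)
  ∈-elements-not⁺ px = ∈-elements⁺ (cong not px)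

  ∈-elements-not⁻ : ∀ {x} → x ∈ elements (not ∘ p) → p x ≡ false
  ∈-elements-not⁻ x∈ = not-injective (∈-elements⁻ x∈)

image : ∀ {k} → (Fin k → Fin n) → Fin n → Bool
image f u = isYes (Fin.any? (λ i → f i Fin.≟ u))

image-∋ : ∀ {k} (f : Fin k → Fin n) i → image f (f i) ≡ true
image-∋ f i with Fin.any? (λ j → f j Fin.≟ f i)
... | yes _ = refl
... | no none = contradiction (i , refl) none

image⁻ : ∀ {k} {f : Fin k → Fin n} {u} → image f u ≡ true → ∃ λ i → f i ≡ u
image⁻ {f = f} {u} e with Fin.any? (λ i → f i Fin.≟ u)
... | yes found = found

k+length-outside-image≤n : ∀ {k} {f : Fin k → Fin n} → Injective _≡_ _≡_ f →
  k + length (elements (not ∘ image f)) ≤ n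
k+length-outside-image≤n {n} {k} {f} f-injective =
  ≤-trans (+-monoˡ-≤ _ k≤length-image) (≤-reflexive length-elements-partition)
  where
  f∈image : map f (allFin k) ⊆ elements (image f)
  f∈image fi∈ with ∈-map⁻ f fi∈
  ... | i , _ , refl = ∈-elements⁺ (image-∋ f i)
  k≤length-image : k ≤ length (elements (image f))
  k≤length-image = subst (_≤ length (elements (image f))) (trans (length-map f (allFin k)) (length-allFin k))
    (Unique-⊆⇒length≤ (Unique.map⁺ f-injective (Unique.allFin⁺ k)) f∈image)

module _ (G : Graph n) where

  adj⇒≢ : ∀ {u w} → adj G u w ≡ true → u ≢ w
  adj⇒≢ {u} uw refl = contradiction (trans (sym uw) (irrefl G u)) λ ()

  Stable : (Fin n → Bool) → Set
  Stable p = ∀ u w → p u ≡ true → p w ≡ true → adj G u w ≡ false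

  IsSplitVertex : Fin n → Set
  IsSplitVertex v = NeighbourhoodComplete G v × ComplementOfNeighbourhoodIndependent G v

  list-clique : {xs : List (Fin n)} → Unique xs →
    (∀ {u w} → u ∈ xs → w ∈ xs → u ≢ w → adj G u w ≡ true) → IsClique G (length xs) (lookup xs)
  list-clique u xs-adjacent =
    lookup-injective u , λ i j i≢j → xs-adjacent (∈-lookup i) (∈-lookup j) (i≢j ∘ lookup-injective u)

  list-independent : {xs : List (Fin n)} → Unique xs →
    (∀ {u w} → u ∈ xs → w ∈ xs → adj G u w ≡ false) → IsIndependent G (length xs) (lookup xs)
  list-independent u xs-nonadjacent =
    lookup-injective u , λ i j → xs-nonadjacent (∈-lookup i) (∈-lookup j)

  clique≤n : ∀ {k f} → IsClique G k f → k ≤ n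
  clique≤n (f-injective , _) = injective⇒≤ f-injective

  clique≤χ : ∀ {k f χ} → IsChromaticNumber G χ → IsClique G k f → k ≤ χ
  clique≤χ {f = f} ((c , c-proper) , _) (_ , f-adjacent) = injective⇒≤ c∘f-injective
    where
    c∘f-injective : Injective _≡_ _≡_ (c ∘ f)
    c∘f-injective {i} {j} e with i Fin.≟ j
    ... | yes i≡j = i≡j
    ... | no i≢j = contradiction e (c-proper (f i) (f j) (f-adjacent i j i≢j))

  ω≤n : ∀ {ω} → IsCliqueNumber G ω → ω ≤ n
  ω≤n ((_ , isClique) , _) = clique≤n isClique

  ω≤χ : ∀ {ω χ} → IsCliqueNumber G ω → IsChromaticNumber G χ → ω ≤ χ
  ω≤χ ((_ , isClique) , _) isχ = clique≤χ isχ isClique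

  neighbours : Fin n → List (Fin n)
  neighbours v = elements (adj G v)

  degree<n : ∀ v → degree G v < n
  degree<n v = Unique⇒length≤ (Unique-∷⁺ (λ v∈N → adj⇒≢ (∈-elements⁻ v∈N) refl) Unique-elements)

  n≤suc-degree : ∀ v → (∀ u → u ≢ v → adj G v u ≡ true) → n ≤ suc (degree G v)
  n≤suc-degree v v-universal = begin
    n                                                  ≡⟨ length-elements-partition ⟨
    degree G v + length (elements (not ∘ adj G v))     ≤⟨ +-monoʳ-≤ (degree G v) non-neighbours≤1 ⟩
    degree G v + 1                                     ≡⟨ +-comm (degree G v) 1 ⟩
    suc (degree G v)                                   ∎
    where
    open ≤-Reasoning
    non-neighbour≡v : ∀ {u} → u ∈ elements (not ∘ adj G v) → u ∈ v ∷ []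
    non-neighbour≡v {u} u∈ with u Fin.≟ v
    ... | yes u≡v = here u≡v
    ... | no u≢v = contradiction (trans (sym (v-universal u u≢v)) (∈-elements-not⁻ u∈)) λ ()
    non-neighbours≤1 : length (elements (not ∘ adj G v)) ≤ 1
    non-neighbours≤1 = Unique-⊆⇒length≤ Unique-elements non-neighbour≡v

  degree≤maxDegree : ∀ v → degree G v ≤ maxDegree G
  degree≤maxDegree v = ≤-foldr-⊔ (degree G) (∈-allFin v)

  maxDegree-attained : 0 < n → ∃ λ v → degree G v ≡ maxDegree G
  maxDegree-attained 0<n with foldr-selective ⊔-sel 0 (map (degree G) (allFin n))
  ... | inj₂ Δ∈degrees with ∈-map⁻ (degree G) Δ∈degrees
  ...   | v , _ , Δ≡deg = v , sym Δ≡deg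
  maxDegree-attained (s≤s _) | inj₁ Δ≡0 =
    zero , trans (n≤0⇒n≡0 (subst (degree G zero ≤_) Δ≡0 (degree≤maxDegree zero))) (sym Δ≡0)

  χ≤length-palette : ∀ {χ} → IsChromaticNumber G χ → (r : Fin n → Fin n) → IsProperColouring G n r →
    {L : List (Fin n)} → (∀ u → r u ∈ L) → χ ≤ length L
  χ≤length-palette (_ , χ-minimal) r r-proper {L} r∈L = χ-minimal (length L) (index ∘ r∈L) proper
    where
    proper : IsProperColouring G (length L) (index ∘ r∈L)
    proper u w uw e = r-proper u w uw (begin
      r u                        ≡⟨ lookup-index (r∈L u) ⟩
      lookup L (index (r∈L u))   ≡⟨ cong (lookup L) e ⟩
      lookup L (index (r∈L w))   ≡⟨ lookup-index (r∈L w) ⟨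
      r w                        ∎)
      where open ≡-Reasoning

  χ≤n : ∀ {χ} → IsChromaticNumber G χ → χ ≤ n
  χ≤n {χ} isχ = subst (χ ≤_) (length-allFin n) (χ≤length-palette isχ id (λ _ _ → adj⇒≢) ∈-allFin)

  colour-used : ∀ {χ c} → IsChromaticNumber G χ → IsProperColouring G χ c → ∀ k → ∃ λ u → c u ≡ k
  colour-used {c = c} isχ c-proper k with Fin.any? (λ u → c u Fin.≟ k)
  ... | yes used = used
  colour-used {suc χ} {c} (_ , χ-minimal) c-proper k | no unused =
    contradiction (χ-minimal χ c′ c′-proper) 1+n≰n
    where
    c′ : Fin n → Fin χ
    c′ u = punchOut {i = k} (λ k≡cu → unused (u , sym k≡cu))
    c′-proper : IsProperColouring G χ c′
    c′-proper u w uw e = c-proper u w uw (punchOut-injective {i = k} _ _ e)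

  recolour-proper : ∀ {k c} → IsProperColouring G k c → ∀ x col →
    (∀ u → c u ≡ col → adj G x u ≡ false) → IsProperColouring G k (updateAt c x (const col))
  recolour-proper {c = c} c-proper x col x-free u w uw e with u Fin.≟ x | w Fin.≟ x
  ... | yes refl | yes refl = adj⇒≢ uw refl
  ... | yes refl | no w≢x =
    contradiction (trans (sym uw) (x-free w (trans (sym (updateAt-minimal w x c w≢x)) (sym e′)))) λ ()
    where
    e′ : col ≡ updateAt c x (const col) w
    e′ = trans (sym (updateAt-updates x c)) e
  ... | no u≢x | yes refl =
    contradiction (trans (sym uw) (trans (adj-sym G u w)
                    (x-free u (trans (sym (updateAt-minimal u x c u≢x)) e′)))) λ ()
    where
    e′ : updateAt c x (const col) u ≡ col
    e′ = trans e (updateAt-updates x c)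
  ... | no u≢x | no w≢x =
    c-proper u w uw (trans (sym (updateAt-minimal u x c u≢x)) (trans e (updateAt-minimal w x c w≢x)))

  image-stable : ∀ {k f} → IsIndependent G k f → Stable (image f)
  image-stable (_ , f-nonadjacent) u w fu fw with image⁻ fu | image⁻ fw
  ... | i , refl | j , refl = f-nonadjacent i j

  χ≤1+length-outside-stable : ∀ {χ p a} → IsChromaticNumber G χ → Stable p → p a ≡ true →
    χ ≤ suc (length (elements (not ∘ p)))
  χ≤1+length-outside-stable {p = p} {a} isχ p-stable pa = χ≤length-palette isχ r r-proper r∈palette
    where
    r : Fin n → Fin n
    r u = if p u then a else u
    r-proper : IsProperColouring G n r
    r-proper u w uw e with p u in pu | p w in pw
    ... | true | true = true≢false (trans (sym uw) (p-stable u w pu pw))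
    ... | true | false = true≢false (trans (sym pa) (trans (cong p e) pw))
    ... | false | true = true≢false (trans (sym pa) (trans (cong p (sym e)) pu))
    ... | false | false = adj⇒≢ uw e
    r∈palette : ∀ u → r u ∈ a ∷ elements (not ∘ p)
    r∈palette u with p u in pu
    ... | true = here refl
    ... | false = there (∈-elements-not⁺ pu)

  -- The stable set takes the colour named y, whose own vertex is merged into x.
  χ≤length-outside-stable-of-nonedge : ∀ {χ p x y} → IsChromaticNumber G χ → Stable p →
    p x ≡ false → p y ≡ false → x ≢ y → adj G x y ≡ false → χ ≤ length (elements (not ∘ p))
  χ≤length-outside-stable-of-nonedge {p = p} {x} {y} isχ p-stable px py x≢y xy =
    χ≤length-palette isχ r r-proper r∈outside
    where
    merge : Fin n → Fin n
    merge u with u Fin.≟ y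
    ... | yes _ = x
    ... | no _ = u
    merge≢y : ∀ u → merge u ≢ y
    merge≢y u with u Fin.≟ y
    ... | yes _ = x≢y
    ... | no u≢y = u≢y
    merge-proper : IsProperColouring G n merge
    merge-proper u w uw with u Fin.≟ y | w Fin.≟ y
    ... | yes refl | yes refl = λ _ → adj⇒≢ uw refl
    ... | yes refl | no _ = λ { refl → true≢false (trans (sym uw) (trans (adj-sym G u x) xy)) }
    ... | no _ | yes refl = λ { refl → true≢false (trans (sym uw) xy) }
    ... | no _ | no _ = adj⇒≢ uw
    r : Fin n → Fin n
    r u = if p u then y else merge u
    r-proper : IsProperColouring G n r
    r-proper u w uw with p u in pu | p w in pw
    ... | true | true = λ _ → true≢false (trans (sym uw) (p-stable u w pu pw))
    ... | true | false = merge≢y w ∘ sym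
    ... | false | true = merge≢y u
    ... | false | false = merge-proper u w uw
    merge∈outside : ∀ u → p u ≡ false → merge u ∈ elements (not ∘ p)
    merge∈outside u pu with u Fin.≟ y
    ... | yes _ = ∈-elements-not⁺ px
    ... | no _ = ∈-elements-not⁺ pu
    r∈outside : ∀ u → r u ∈ elements (not ∘ p)
    r∈outside u with p u in pu
    ... | true = ∈-elements-not⁺ py
    ... | false = merge∈outside u pu

  -- Every vertex of p takes the colour named by a non-neighbour g u outside p.
  χ≤length-outside-stable-of-nonneighbours : ∀ {χ p} → IsChromaticNumber G χ → Stable p →
    (g : Fin n → Fin n) → (∀ u → p u ≡ true → p (g u) ≡ false × adj G u (g u) ≡ false) →
    χ ≤ length (elements (not ∘ p))
  χ≤length-outside-stable-of-nonneighbours {p = p} isχ p-stable g g-nonneighbour =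
    χ≤length-palette isχ r r-proper r∈outside
    where
    r : Fin n → Fin n
    r u = if p u then g u else u
    r-proper : IsProperColouring G n r
    r-proper u w uw e with p u in pu | p w in pw
    ... | true | true = true≢false (trans (sym uw) (p-stable u w pu pw))
    ... | true | false = true≢false (trans (sym uw)
                           (subst (λ z → adj G u z ≡ false) e (proj₂ (g-nonneighbour u pu))))
    ... | false | true = true≢false (trans (sym uw) (trans (adj-sym G u w)
                           (subst (λ z → adj G w z ≡ false) (sym e) (proj₂ (g-nonneighbour w pw)))))
    ... | false | false = adj⇒≢ uw e
    r∈outside : ∀ u → r u ∈ elements (not ∘ p)
    r∈outside u with p u in pu
    ... | true = ∈-elements-not⁺ (proj₁ (g-nonneighbour u pu))
    ... | false = ∈-elements-not⁺ pu

  α+χ≤n+1 : ∀ {α χ} → IsIndependenceNumber G α → IsChromaticNumber G χ → α + χ ≤ suc n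
  α+χ≤n+1 {zero} _ isχ = m≤n⇒m≤1+n (χ≤n isχ)
  α+χ≤n+1 {suc α} {χ} ((f , isIndependent) , _) isχ = begin
    suc α + χ                                              ≤⟨ +-monoʳ-≤ (suc α) χ≤1+outside ⟩
    suc α + suc (length (elements (not ∘ image f)))        ≡⟨ cong suc (+-suc α _) ⟩
    suc (suc α + length (elements (not ∘ image f)))        ≤⟨ s≤s (k+length-outside-image≤n (proj₁ isIndependent)) ⟩
    suc n                                                  ∎
    where
    open ≤-Reasoning
    χ≤1+outside : χ ≤ suc (length (elements (not ∘ image f)))
    χ≤1+outside = χ≤1+length-outside-stable isχ (image-stable isIndependent) (image-∋ f zero)

  split-vertex⇒n+1≤α+χ : ∀ {α χ} → IsIndependenceNumber G α → IsChromaticNumber G χ →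
    ∀ {v} → IsSplitVertex v → suc n ≤ α + χ
  split-vertex⇒n+1≤α+χ {α} {χ} (_ , α-maximal) isχ {v} (N-complete , co-N-independent) = begin
    suc n                                                  ≡⟨ cong suc length-elements-partition ⟨
    suc (degree G v) + length (elements (not ∘ adj G v))   ≤⟨ +-mono-≤ (clique≤χ isχ N[v]-clique)
                                                                (α-maximal _ _ co-N-independent′) ⟩
    χ + α                                                  ≡⟨ +-comm χ α ⟩
    α + χ                                                  ∎
    where
    open ≤-Reasoning
    v∉N : v ∉ neighbours v
    v∉N v∈N = adj⇒≢ (∈-elements⁻ v∈N) refl
    N[v]-adjacent : ∀ {u w} → u ∈ v ∷ neighbours v → w ∈ v ∷ neighbours v → u ≢ w → adj G u w ≡ true
    N[v]-adjacent (here refl) (here refl) u≢w = contradiction refl u≢w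
    N[v]-adjacent (here refl) (there w∈N) _ = ∈-elements⁻ w∈N
    N[v]-adjacent (there u∈N) (here refl) _ = trans (adj-sym G _ v) (∈-elements⁻ u∈N)
    N[v]-adjacent (there u∈N) (there w∈N) u≢w = N-complete _ _ (∈-elements⁻ u∈N) (∈-elements⁻ w∈N) u≢w
    N[v]-clique = list-clique (Unique-∷⁺ v∉N Unique-elements) N[v]-adjacent
    co-N-independent′ = list-independent Unique-elements λ u∈ w∈ →
      co-N-independent _ _ (∈-elements-not⁻ u∈) (∈-elements-not⁻ w∈)

  split-vertex-of-large-stable : ∀ {χ p} → IsChromaticNumber G χ → Stable p →
    length (elements (not ∘ p)) < χ → ∃ IsSplitVertex
  split-vertex-of-large-stable {p = p} isχ p-stable |J|<χ
    with Fin.any? (λ v → (p v Bool.≟ true) ×-dec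
                         Fin.all? (λ w → (p w Bool.≟ false) →-dec (adj G v w Bool.≟ true)))
  ... | yes (v , pv , v-dominating) = v , N-complete , co-N-independent
    where
    outside-complete : ∀ u w → p u ≡ false → p w ≡ false → u ≢ w → adj G u w ≡ true
    outside-complete u w pu pw u≢w = ¬-not λ uw →
      <⇒≱ |J|<χ (χ≤length-outside-stable-of-nonedge isχ p-stable pu pw u≢w uw)
    neighbour-outside : ∀ u → adj G v u ≡ true → p u ≡ false
    neighbour-outside u vu = ¬-not λ pu → true≢false (trans (sym vu) (p-stable v u pv pu))
    N-complete : NeighbourhoodComplete G v
    N-complete u w vu vw = outside-complete u w (neighbour-outside u vu) (neighbour-outside w vw)
    non-neighbour-inside : ∀ u → adj G v u ≡ false → p u ≡ true
    non-neighbour-inside u vu = ¬-not λ pu → true≢false (trans (sym (v-dominating u pu)) vu)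
    co-N-independent : ComplementOfNeighbourhoodIndependent G v
    co-N-independent u w vu vw = p-stable u w (non-neighbour-inside u vu) (non-neighbour-inside w vw)
  ... | no none-dominating =
    contradiction (χ≤length-outside-stable-of-nonneighbours isχ p-stable g g-nonneighbour) (<⇒≱ |J|<χ)
    where
    g : Fin n → Fin n
    g u with Fin.any? (λ w → (p w Bool.≟ false) ×-dec (adj G u w Bool.≟ false))
    ... | yes (w , _) = w
    ... | no _ = u
    g-nonneighbour : ∀ u → p u ≡ true → p (g u) ≡ false × adj G u (g u) ≡ false
    g-nonneighbour u pu with Fin.any? (λ w → (p w Bool.≟ false) ×-dec (adj G u w Bool.≟ false))
    ... | yes (_ , spec) = spec
    ... | no none = contradiction (u , pu , λ w pw → ¬-not λ uw → none (w , pw , uw)) none-dominating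

  α+χ≡n+1⇒split-vertex : ∀ {α χ} → IsIndependenceNumber G α → IsChromaticNumber G χ →
    α + χ ≡ suc n → ∃ IsSplitVertex
  α+χ≡n+1⇒split-vertex {α} {χ} ((f , isIndependent) , _) isχ α+χ≡n+1 =
    split-vertex-of-large-stable isχ (image-stable isIndependent) (+-cancelˡ-< α _ χ (begin-strict
      α + length (elements (not ∘ image f))   ≤⟨ k+length-outside-image≤n (proj₁ isIndependent) ⟩
      n                                       <⟨ n<1+n n ⟩
      suc n                                   ≡⟨ α+χ≡n+1 ⟨
      α + χ                                   ∎))
    where open ≤-Reasoning

  α+χ≤n+1-with-equality : ∀ {α χ} → IsIndependenceNumber G α → IsChromaticNumber G χ →
    (α + χ ≤ n + 1) × ((α + χ ≡ n + 1) ⇔ ∃ IsSplitVertex)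
  α+χ≤n+1-with-equality {α} {χ} isα isχ =
    subst (α + χ ≤_) n+1≡ (α+χ≤n+1 isα isχ) ,
    mk⇔ (α+χ≡n+1⇒split-vertex isα isχ ∘ (λ e → trans e (sym n+1≡)))
        (λ (_ , split) →
          trans (≤-antisym (α+χ≤n+1 isα isχ) (split-vertex⇒n+1≤α+χ isα isχ split)) n+1≡)
    where
    n+1≡ : suc n ≡ n + 1
    n+1≡ = +-comm 1 n

  triangle-clique : ∀ {a b c} → adj G a b ≡ true → adj G b c ≡ true → adj G a c ≡ true →
    IsClique G 3 (lookup (a ∷ b ∷ c ∷ []))
  triangle-clique {a} {b} {c} ab bc ac = list-clique distinct adjacent
    where
    distinct : Unique (a ∷ b ∷ c ∷ [])
    distinct = (adj⇒≢ ab All.∷ adj⇒≢ ac All.∷ All.[]) ∷ (adj⇒≢ bc All.∷ All.[]) ∷ All.[] ∷ []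
    ba = trans (adj-sym G b a) ab
    cb = trans (adj-sym G c b) bc
    ca = trans (adj-sym G c a) ac
    adjacent : ∀ {u w} → u ∈ a ∷ b ∷ c ∷ [] → w ∈ a ∷ b ∷ c ∷ [] → u ≢ w → adj G u w ≡ true
    adjacent (here refl)                 (there (here refl))         _ = ab
    adjacent (here refl)                 (there (there (here refl))) _ = ac
    adjacent (there (here refl))         (here refl)                 _ = ba
    adjacent (there (here refl))         (there (there (here refl))) _ = bc
    adjacent (there (there (here refl))) (here refl)                 _ = ca
    adjacent (there (there (here refl))) (there (here refl))         _ = cb
    adjacent (here refl)                 (here refl)                 u≢u = contradiction refl u≢u
    adjacent (there (here refl))         (there (here refl))         u≢u = contradiction refl u≢u
    adjacent (there (there (here refl))) (there (there (here refl))) u≢u = contradiction refl u≢u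

  neighbourhood-stable : IsCliqueNumber G 2 → ∀ v → Stable (adj G v)
  neighbourhood-stable (_ , ω-maximal) v u w vu vw =
    ¬-not λ uw → contradiction (ω-maximal 3 _ (triangle-clique vu uw vw)) λ { (s≤s (s≤s ())) }

  degree+χ≤n+1 : ∀ {χ} → IsCliqueNumber G 2 → IsChromaticNumber G χ → ∀ v → degree G v + χ ≤ suc n
  degree+χ≤n+1 {χ} isω isχ v with neighbours v in N≡
  ... | [] = m≤n⇒m≤1+n (χ≤n isχ)
  ... | a ∷ _ = subst (λ N → length N + χ ≤ suc n) N≡ (begin
    degree G v + χ                                           ≤⟨ +-monoʳ-≤ (degree G v) χ≤1+non-neighbours ⟩
    degree G v + suc (length (elements (not ∘ adj G v)))     ≡⟨ +-suc _ _ ⟩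
    suc (degree G v + length (elements (not ∘ adj G v)))     ≡⟨ cong suc length-elements-partition ⟩
    suc n                                                    ∎)
    where
    open ≤-Reasoning
    χ≤1+non-neighbours = χ≤1+length-outside-stable isχ (neighbourhood-stable isω v)
                           (∈-elements⁻ (subst (a ∈_) (sym N≡) (here refl)))

  universal⇒star : ∀ v → (∀ u → u ≢ v → adj G v u ≡ true) → Stable (adj G v) → IsStar G
  universal⇒star v v-universal N-stable = v , λ u w u≢w → edge-at-v u w , at-v-edge u w u≢w
    where
    edge-at-v : ∀ u w → adj G u w ≡ true → u ≡ v ⊎ w ≡ v
    edge-at-v u w uw with u Fin.≟ v | w Fin.≟ v
    ... | yes u≡v | _ = inj₁ u≡v
    ... | no _ | yes w≡v = inj₂ w≡v
    ... | no u≢v | no w≢v =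
      contradiction (trans (sym uw) (N-stable u w (v-universal u u≢v) (v-universal w w≢v))) true≢false
    at-v-edge : ∀ u w → u ≢ w → u ≡ v ⊎ w ≡ v → adj G u w ≡ true
    at-v-edge u w u≢w (inj₁ refl) = v-universal w (u≢w ∘ sym)
    at-v-edge u w u≢w (inj₂ refl) = trans (adj-sym G u w) (v-universal u u≢w)

  star-of-degree+χ≡n+1 : ∀ {χ} → IsCliqueNumber G 2 → IsChromaticNumber G χ →
    ∀ v → degree G v + χ ≡ suc n → IsStar G
  star-of-degree+χ≡n+1 {χ} isω isχ v d+χ≡n+1 = universal⇒star v v-universal (neighbourhood-stable isω v)
    where
    v-universal : ∀ u → u ≢ v → adj G v u ≡ true
    v-universal u u≢v = ¬-not λ vu → <⇒≱ (n<1+n n) (begin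
      suc n                                                ≡⟨ d+χ≡n+1 ⟨
      degree G v + χ                                       ≤⟨ +-monoʳ-≤ (degree G v)
        (χ≤length-outside-stable-of-nonedge isχ (neighbourhood-stable isω v) (irrefl G v) vu (u≢v ∘ sym) vu) ⟩
      degree G v + length (elements (not ∘ adj G v))       ≡⟨ length-elements-partition ⟩
      n                                                    ∎)
      where open ≤-Reasoning

module ColourClasses {n} (G : Graph n) {χ} (isχ : IsChromaticNumber G χ) where

  private
    c : Fin n → Fin χ
    c = proj₁ (proj₁ isχ)
    c-proper : IsProperColouring G χ c
    c-proper = proj₂ (proj₁ isχ)

  rep : Fin χ → Fin n
  rep k = proj₁ (colour-used G isχ c-proper k)

  c-rep : ∀ k → c (rep k) ≡ k
  c-rep k = proj₂ (colour-used G isχ c-proper k)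

  HasPartner : Fin χ → Set
  HasPartner k = ∃ λ u → u ≢ rep k × c u ≡ k

  hasPartner? : ∀ k → Dec (HasPartner k)
  hasPartner? k = Fin.any? (λ u → ¬? (u Fin.≟ rep k) ×-dec (c u Fin.≟ k))

  singleton : Fin χ → Bool
  singleton k = not (isYes (hasPartner? k))

  partner : Fin χ → Fin n
  partner k with hasPartner? k
  ... | yes (u , _) = u
  ... | no _ = rep k

  c-partner : ∀ k → c (partner k) ≡ k
  c-partner k with hasPartner? k
  ... | yes (_ , _ , cu≡k) = cu≡k
  ... | no _ = c-rep k

  partner≢rep : ∀ {k} → singleton k ≡ false → partner k ≢ rep k
  partner≢rep {k} _ with hasPartner? k
  ... | yes (_ , u≢rep , _) = u≢rep

  singleton-unique : ∀ {k} → singleton k ≡ true → ∀ {u} → c u ≡ k → u ≡ rep k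
  singleton-unique {k} _ {u} cu≡k with hasPartner? k
  ... | no no-partner with u Fin.≟ rep k
  ...   | yes u≡rep = u≡rep
  ...   | no u≢rep = contradiction (u , u≢rep , cu≡k) no-partner

  same-colour : ∀ {u w} → c u ≡ c w → ∀ {k} → u ≡ rep k ⊎ u ≡ partner k → c w ≡ k
  same-colour cu≡cw {k} (inj₁ refl) = trans (sym cu≡cw) (c-rep k)
  same-colour cu≡cw {k} (inj₂ refl) = trans (sym cu≡cw) (c-partner k)

  rep-injective : Injective _≡_ _≡_ rep
  rep-injective {k} {k′} e = trans (sym (c-rep k)) (same-colour refl (inj₁ e))

  partner-injective : Injective _≡_ _≡_ partner
  partner-injective {k} {k′} e = trans (sym (c-partner k)) (same-colour refl (inj₂ e))

  Singletons NonSingletons : List (Fin χ)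
  Singletons = elements singleton
  NonSingletons = elements (not ∘ singleton)

  RepsAndPartners : List (Fin n)
  RepsAndPartners = map rep (allFin χ) ++ map partner NonSingletons

  Unique-RepsAndPartners : Unique RepsAndPartners
  Unique-RepsAndPartners = Unique.++⁺ (Unique.map⁺ rep-injective (Unique.allFin⁺ χ))
                               (Unique.map⁺ partner-injective Unique-elements) disjoint
    where
    disjoint : ∀ {u} → ¬ (u ∈ map rep (allFin χ) × u ∈ map partner NonSingletons)
    disjoint (u∈reps , u∈partners) with ∈-map⁻ rep u∈reps | ∈-map⁻ partner u∈partners
    ... | k , _ , refl | k′ , k′∈T , rep≡partner =
      partner≢rep (∈-elements-not⁻ k′∈T) (trans (sym rep≡partner) (cong rep k≡k′))
      where
      k≡k′ : k ≡ k′
      k≡k′ = trans (sym (c-rep k)) (same-colour refl (inj₂ rep≡partner))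

  length-RepsAndPartners : length RepsAndPartners ≡ χ + length NonSingletons
  length-RepsAndPartners = trans (length-++ (map rep (allFin χ)))
    (cong₂ _+_ (trans (length-map rep (allFin χ)) (length-allFin χ)) (length-map partner NonSingletons))

  χ+#nonsingletons≤n : χ + length NonSingletons ≤ n
  χ+#nonsingletons≤n = subst (_≤ n) length-RepsAndPartners (Unique⇒length≤ Unique-RepsAndPartners)

  -- Otherwise the vertex of colour k′ could be recoloured k, leaving colour k′ unused.
  singletons-adjacent : ∀ {k k′} → singleton k ≡ true → singleton k′ ≡ true → k ≢ k′ →
    adj G (rep k) (rep k′) ≡ true
  singletons-adjacent {k} {k′} sk sk′ k≢k′ = ¬-not λ nonadjacent →
    k′-unused nonadjacent (colour-used G isχ (c′-proper nonadjacent) k′)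
    where
    c′ : Fin n → Fin χ
    c′ = updateAt c (rep k′) (const k)
    c′-proper : adj G (rep k) (rep k′) ≡ false → IsProperColouring G χ c′
    c′-proper nonadjacent = recolour-proper G c-proper (rep k′) k λ u cu≡k →
      subst (λ z → adj G (rep k′) z ≡ false) (sym (singleton-unique sk cu≡k))
            (trans (adj-sym G (rep k′) (rep k)) nonadjacent)
    k′-unused : adj G (rep k) (rep k′) ≡ false → ¬ ∃ λ u → c′ u ≡ k′
    k′-unused _ (u , c′u≡k′) with u Fin.≟ rep k′
    ... | yes refl = k≢k′ (trans (sym (updateAt-updates (rep k′) c)) c′u≡k′)
    ... | no u≢rep =
      u≢rep (singleton-unique sk′ (trans (sym (updateAt-minimal u (rep k′) c u≢rep)) c′u≡k′))

  singleton-reps-adjacent : ∀ {u w} → u ∈ map rep Singletons → w ∈ map rep Singletons → u ≢ w →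
    adj G u w ≡ true
  singleton-reps-adjacent u∈ w∈ u≢w with ∈-map⁻ rep u∈ | ∈-map⁻ rep w∈
  ... | k , k∈S , refl | k′ , k′∈S , refl =
    singletons-adjacent (∈-elements⁻ k∈S) (∈-elements⁻ k′∈S) (u≢w ∘ cong rep)

  #singletons≤ω : ∀ {ω} → IsCliqueNumber G ω → length Singletons ≤ ω
  #singletons≤ω (_ , ω-maximal) = subst (_≤ _) (length-map rep Singletons)
    (ω-maximal _ _ (list-clique G (Unique.map⁺ rep-injective Unique-elements) singleton-reps-adjacent))

  χ+χ≡#singletons+[χ+#nonsingletons] : χ + χ ≡ length Singletons + (χ + length NonSingletons)
  χ+χ≡#singletons+[χ+#nonsingletons] = begin
    χ + χ                                                 ≡⟨ cong (_+ χ) length-elements-partition ⟨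
    length Singletons + length NonSingletons + χ          ≡⟨ +-assoc (length Singletons) _ χ ⟩
    length Singletons + (length NonSingletons + χ)        ≡⟨ cong (length Singletons +_) (+-comm _ χ) ⟩
    length Singletons + (χ + length NonSingletons)        ∎
    where open ≡-Reasoning

  χ+χ≤n+ω : ∀ {ω} → IsCliqueNumber G ω → χ + χ ≤ n + ω
  χ+χ≤n+ω {ω} isω = begin
    χ + χ                                                 ≡⟨ χ+χ≡#singletons+[χ+#nonsingletons] ⟩
    length Singletons + (χ + length NonSingletons)        ≤⟨ +-mono-≤ (#singletons≤ω isω) χ+#nonsingletons≤n ⟩
    ω + n                                                 ≡⟨ +-comm ω n ⟩
    n + ω                                                 ∎
    where open ≤-Reasoning

  nonadjacent-singleton : ∀ {ω} → IsCliqueNumber G ω → length Singletons ≡ ω →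
    ∀ w → singleton (c w) ≡ false → ∃ λ k → singleton k ≡ true × adj G w (rep k) ≡ false
  nonadjacent-singleton (_ , ω-maximal) #S≡ω w sw
    with Fin.any? (λ k → (singleton k Bool.≟ true) ×-dec (adj G w (rep k) Bool.≟ false))
  ... | yes found = found
  ... | no none =
    contradiction (subst (λ m → suc m ≤ _) (trans (length-map rep Singletons) #S≡ω) ω+1≤ω) 1+n≰n
    where
    w-adjacent : ∀ {u} → u ∈ map rep Singletons → adj G w u ≡ true
    w-adjacent u∈ with ∈-map⁻ rep u∈
    ... | k , k∈S , refl = ¬-not λ e → none (k , ∈-elements⁻ k∈S , e)
    w∉ : w ∉ map rep Singletons
    w∉ w∈ with ∈-map⁻ rep w∈
    ... | k , k∈S , refl =
      true≢false (trans (sym (∈-elements⁻ k∈S)) (trans (cong singleton (sym (c-rep k))) sw))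
    adjacent : ∀ {u v} → u ∈ w ∷ map rep Singletons → v ∈ w ∷ map rep Singletons → u ≢ v → adj G u v ≡ true
    adjacent (here refl) (here refl) u≢u = contradiction refl u≢u
    adjacent (here refl) (there v∈) _ = w-adjacent v∈
    adjacent (there u∈) (here refl) _ = trans (adj-sym G _ w) (w-adjacent u∈)
    adjacent (there u∈) (there v∈) u≢v = singleton-reps-adjacent u∈ v∈ u≢v
    ω+1≤ω =
      ω-maximal _ _ (list-clique G (Unique-∷⁺ w∉ (Unique.map⁺ rep-injective Unique-elements)) adjacent)

  two-per-class : χ + length NonSingletons ≡ n → ∀ {u k} → c u ≡ k → u ≡ rep k ⊎ u ≡ partner k
  two-per-class χ+#T≡n {u} {k} cu≡k
    with ∈-++⁻ (map rep (allFin χ))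
               (Unique-length≡⇒∈ Unique-RepsAndPartners (trans length-RepsAndPartners χ+#T≡n) u)
  ... | inj₁ u∈reps with ∈-map⁻ rep u∈reps
  ...   | k′ , _ , refl = inj₁ (cong rep (trans (sym (c-rep k′)) cu≡k))
  two-per-class χ+#T≡n {u} {k} cu≡k | inj₂ u∈partners with ∈-map⁻ partner u∈partners
  ...   | k′ , _ , refl = inj₂ (cong partner (trans (sym (c-partner k′)) cu≡k))

  nonsingleton-impossible : ∀ {ω} → IsCliqueNumber G ω → length Singletons ≡ ω →
    χ + length NonSingletons ≡ n → ∀ t → singleton t ≢ false
  nonsingleton-impossible isω #S≡ω χ+#T≡n t st
    with nonadjacent-singleton isω #S≡ω (rep t) (trans (cong singleton (c-rep t)) st)
       | nonadjacent-singleton isω #S≡ω (partner t) (trans (cong singleton (c-partner t)) st)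
  ... | kx , skx , x-kx | ky , sky , y-ky = t-unused (colour-used G isχ c₂-proper t)
    where
    x y : Fin n
    x = rep t
    y = partner t
    xy : adj G x y ≡ false
    xy = ¬-not λ e → c-proper x y e (trans (c-rep t) (sym (c-partner t)))
    c₁ c₂ : Fin n → Fin χ
    c₁ = updateAt c x (const kx)
    c₂ = updateAt c₁ y (const ky)
    c₁-proper : IsProperColouring G χ c₁
    c₁-proper = recolour-proper G c-proper x kx λ u cu≡kx →
      subst (λ z → adj G x z ≡ false) (sym (singleton-unique skx cu≡kx)) x-kx
    y-free : ∀ u → c₁ u ≡ ky → adj G y u ≡ false
    y-free u c₁u≡ky with u Fin.≟ x
    ... | yes refl = trans (adj-sym G y x) xy
    ... | no u≢x = subst (λ z → adj G y z ≡ false)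
      (sym (singleton-unique sky (trans (sym (updateAt-minimal u x c u≢x)) c₁u≡ky))) y-ky
    c₂-proper : IsProperColouring G χ c₂
    c₂-proper = recolour-proper G c₁-proper y ky y-free
    ≢t : ∀ {k} → singleton k ≡ true → k ≢ t
    ≢t sk refl = true≢false (trans (sym sk) st)
    t-unused : ¬ ∃ λ u → c₂ u ≡ t
    t-unused (u , c₂u≡t) with u Fin.≟ y | u Fin.≟ x
    ... | yes refl | _ = ≢t sky (trans (sym (updateAt-updates y c₁)) c₂u≡t)
    ... | no u≢y | yes refl =
      ≢t skx (trans (sym (updateAt-updates x c)) (trans (sym (updateAt-minimal x y c₁ u≢y)) c₂u≡t))
    ... | no u≢y | no u≢x = [ u≢x , u≢y ]′
      (two-per-class χ+#T≡n
        (trans (sym (updateAt-minimal u x c u≢x)) (trans (sym (updateAt-minimal u y c₁ u≢y)) c₂u≡t)))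

  χ+χ≡n+ω⇒ω≡n : ∀ {ω} → IsCliqueNumber G ω → χ + χ ≡ n + ω → ω ≡ n
  χ+χ≡n+ω⇒ω≡n {ω} isω χ+χ≡n+ω = begin
    ω                                                     ≡⟨ #S≡ω ⟨
    length Singletons                                     ≡⟨ +-identityʳ _ ⟨
    length Singletons + 0                                 ≡⟨ cong (length Singletons +_) #T≡0 ⟨
    length Singletons + length NonSingletons              ≡⟨ length-elements-partition ⟩
    χ                                                     ≡⟨ +-identityʳ χ ⟨
    χ + 0                                                 ≡⟨ cong (χ +_) #T≡0 ⟨
    χ + length NonSingletons                              ≡⟨ χ+#T≡n ⟩
    n                                                     ∎
    where
    open ≡-Reasoning
    tight = +-≤-≡⇒≡ (#singletons≤ω isω) χ+#nonsingletons≤n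
              (trans (sym χ+χ≡#singletons+[χ+#nonsingletons]) (trans χ+χ≡n+ω (+-comm n ω)))
    #S≡ω = proj₁ tight
    χ+#T≡n = proj₂ tight
    #T≡0 : length NonSingletons ≡ 0
    #T≡0 = n≤0⇒n≡0 (Unique-⊆⇒length≤ {ys = []} (Unique-elements {p = not ∘ singleton}) λ t∈ →
             ⊥-elim (nonsingleton-impossible isω #S≡ω χ+#T≡n _ (∈-elements-not⁻ t∈)))

module _ {q n d χ : ℕ} where

  -- b, a, e are the slacks of d < n, 2χ ≤ n + ω and ω ≤ n for ω = 3 + q; the identity is arranged so that
  -- no subtraction occurs.
  weighted-slack-identity : ∀ {a b e} → suc d + b ≡ n → χ + χ + a ≡ n + (3 + q) → 3 + q + e ≡ n →
    2 * (d + χ * (2 + q)) + (2 * b + a * (2 + q) + q * e) ≡ 2 * ((n + 1) * (2 + q))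
  weighted-slack-identity {a} {b} {e} d+b≡n 2χ+a≡n+ω ω+e≡n = +-cancelʳ-≡ 2 _ _ (begin
      2 * (d + χ * (2 + q)) + (2 * b + a * (2 + q) + q * e) + 2
    ≡⟨ solve (d ∷ χ ∷ a ∷ b ∷ q ∷ e ∷ []) ⟩
      2 * (suc d + b) + (χ + χ + a) * (2 + q) + q * e
    ≡⟨ cong₂ (λ x y → 2 * x + y * (2 + q) + q * e) d+b≡n 2χ+a≡n+ω ⟩
      2 * n + (n + (3 + q)) * (2 + q) + q * e
    ≡⟨ cong (λ x → 2 * x + (x + (3 + q)) * (2 + q) + q * e) (sym ω+e≡n) ⟩
      2 * (3 + q + e) + ((3 + q + e) + (3 + q)) * (2 + q) + q * e
    ≡⟨ solve (q ∷ e ∷ []) ⟩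
      2 * ((3 + q + e + 1) * (2 + q)) + 2
    ≡⟨ cong (λ x → 2 * ((x + 1) * (2 + q)) + 2) ω+e≡n ⟩
      2 * ((n + 1) * (2 + q)) + 2 ∎)
    where open ≡-Reasoning

  weighted-bound : d < n → χ + χ ≤ n + (3 + q) → 3 + q ≤ n →
    (d + χ * (2 + q) ≤ (n + 1) * (2 + q)) × (d + χ * (2 + q) ≡ (n + 1) * (2 + q) → χ + χ ≡ n + (3 + q))
  weighted-bound d<n 2χ≤n+ω ω≤n
    with b , d+b≡n ← m≤n⇒∃[o]m+o≡n d<n
       | a , 2χ+a≡n+ω ← m≤n⇒∃[o]m+o≡n 2χ≤n+ω
       | e , ω+e≡n ← m≤n⇒∃[o]m+o≡n ω≤n = bound , tight
    where
    identity = weighted-slack-identity d+b≡n 2χ+a≡n+ω ω+e≡n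
    slack = 2 * b + a * (2 + q) + q * e
    bound : d + χ * (2 + q) ≤ (n + 1) * (2 + q)
    bound = *-cancelˡ-≤ 2 (subst (2 * (d + χ * (2 + q)) ≤_) identity (m≤m+n _ slack))
    tight : d + χ * (2 + q) ≡ (n + 1) * (2 + q) → χ + χ ≡ n + (3 + q)
    tight eq = trans (sym (+-identityʳ _)) (trans (cong (χ + χ +_) (sym a≡0)) 2χ+a≡n+ω)
      where
      slack≡0 : slack ≡ 0
      slack≡0 = +-cancelˡ-≡ (2 * (d + χ * (2 + q))) slack 0
        (trans identity (trans (cong (2 *_) (sym eq)) (sym (+-identityʳ _))))
      a≡0 : a ≡ 0
      a≡0 = m*n≡0⇒m≡0 a (2 + q) (m+n≡0⇒n≡0 (2 * b) (m+n≡0⇒m≡0 (2 * b + a * (2 + q)) slack≡0))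

module _ (G : Graph n) where

  ω≡n⇒complete : ∀ {ω} → IsCliqueNumber G ω → ω ≡ n → IsComplete G
  ω≡n⇒complete ((_ , f-injective , f-adjacent) , _) refl u w u≢w
    with injective⇒surjective f-injective u | injective⇒surjective f-injective w
  ... | i , refl | j , refl = f-adjacent i j (u≢w ∘ cong _)

  star-triangle-free : IsStar G → ∀ {a b c} →
    adj G a b ≡ true → adj G b c ≡ true → adj G a c ≡ true → ⊥
  star-triangle-free (o , star) {a} {b} {c} ab bc ac with a Fin.≟ o
  ... | yes refl = [ adj⇒≢ G ab ∘ sym , adj⇒≢ G ac ∘ sym ]′ (proj₁ (star b c (adj⇒≢ G bc)) bc)
  ... | no a≢o = adj⇒≢ G bc (trans (other-end ab) (sym (other-end ac)))
    where
    other-end : ∀ {x} → adj G a x ≡ true → x ≡ o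
    other-end {x} ax = [ (λ a≡o → contradiction a≡o a≢o) , id ]′ (proj₁ (star a x (adj⇒≢ G ax)) ax)

  star⇒ω≤2 : ∀ {ω} → IsStar G → IsCliqueNumber G ω → ω ≤ 2
  star⇒ω≤2 {0} _ _ = z≤n
  star⇒ω≤2 {1} _ _ = s≤s z≤n
  star⇒ω≤2 {2} _ _ = ≤-refl
  star⇒ω≤2 {suc (suc (suc _))} star ((f , _ , f-adjacent) , _) = ⊥-elim
    (star-triangle-free star (f-adjacent zero (suc zero) λ ()) (f-adjacent (suc zero) (suc (suc zero)) λ ())
                             (f-adjacent zero (suc (suc zero)) λ ()))

  [n+1]≤Δ+χ-of-star : ∀ {χ} → IsStar G → IsCliqueNumber G 2 → IsChromaticNumber G χ →
    n + 1 ≤ maxDegree G + χ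
  [n+1]≤Δ+χ-of-star {χ} (o , star) isω isχ = begin
    n + 1                    ≡⟨ +-comm n 1 ⟩
    suc n                    ≤⟨ s≤s (≤-trans (n≤suc-degree G o o-universal) (s≤s (degree≤maxDegree G o))) ⟩
    suc (suc (maxDegree G))  ≡⟨ +-comm 2 (maxDegree G) ⟩
    maxDegree G + 2          ≤⟨ +-monoʳ-≤ (maxDegree G) (ω≤χ G isω isχ) ⟩
    maxDegree G + χ          ∎
    where
    open ≤-Reasoning
    o-universal : ∀ u → u ≢ o → adj G o u ≡ true
    o-universal u u≢o = proj₂ (star o u (u≢o ∘ sym)) (inj₁ refl)

  [n+1]m≤Δ+χm-of-complete : ∀ {m χ} → IsComplete G → IsCliqueNumber G (suc m) → IsChromaticNumber G χ →
    (n + 1) * m ≤ maxDegree G + χ * m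
  [n+1]m≤Δ+χm-of-complete {m} {χ} complete isω isχ = begin
    (n + 1) * m              ≡⟨ cong (λ k → (k + 1) * m) ω≡n ⟨
    (suc m + 1) * m          ≡⟨ cong (_* m) (+-comm (suc m) 1) ⟩
    m + suc m * m            ≤⟨ +-mono-≤ m≤Δ (*-monoˡ-≤ m (ω≤χ G isω isχ)) ⟩
    maxDegree G + χ * m      ∎
    where
    open ≤-Reasoning
    ω≡n : suc m ≡ n
    ω≡n = ≤-antisym (ω≤n G isω) (proj₂ isω n id (id , complete))
    v : Fin n
    v = subst Fin ω≡n zero
    m≤Δ : m ≤ maxDegree G
    m≤Δ = ≤-pred (subst (_≤ suc (maxDegree G)) (sym ω≡n)
            (≤-trans (n≤suc-degree G v (λ u u≢v → complete v u (u≢v ∘ sym))) (s≤s (degree≤maxDegree G v))))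

  Δ+χ≤n+1-of-ω≡2 : ∀ {χ} → IsCliqueNumber G 2 → IsChromaticNumber G χ →
    (maxDegree G + χ ≤ n + 1) × (maxDegree G + χ ≡ n + 1 → IsStar G)
  Δ+χ≤n+1-of-ω≡2 {χ} isω isχ with maxDegree-attained G (≤-trans (s≤s z≤n) (ω≤n G isω))
  ... | v , deg≡Δ rewrite sym deg≡Δ | +-comm n 1 =
    degree+χ≤n+1 G isω isχ v , star-of-degree+χ≡n+1 G isω isχ v

  Δ+χ[ω∸1]≤[n+1][ω∸1]-of-ω≥3 : ∀ {q χ} → IsCliqueNumber G (3 + q) → IsChromaticNumber G χ →
    (maxDegree G + χ * (2 + q) ≤ (n + 1) * (2 + q))
    × (maxDegree G + χ * (2 + q) ≡ (n + 1) * (2 + q) → IsComplete G)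
  Δ+χ[ω∸1]≤[n+1][ω∸1]-of-ω≥3 {q} {χ} isω isχ
    with maxDegree-attained G (≤-trans (s≤s z≤n) (ω≤n G isω))
  ... | v , deg≡Δ rewrite sym deg≡Δ =
    proj₁ bound , ω≡n⇒complete isω ∘ ColourClasses.χ+χ≡n+ω⇒ω≡n G isχ isω ∘ proj₂ bound
    where
    bound = weighted-bound {χ = χ} (degree<n G v) (ColourClasses.χ+χ≤n+ω G isχ isω) (ω≤n G isω)

  Δ+χ[ω∸1]≤[n+1][ω∸1] : ∀ {ω χ} → IsCliqueNumber G ω → IsChromaticNumber G χ → 2 ≤ ω →
    (maxDegree G + χ * (ω ∸ 1) ≤ (n + 1) * (ω ∸ 1))
    × ((maxDegree G + χ * (ω ∸ 1) ≡ (n + 1) * (ω ∸ 1)) ⇔ (IsComplete G ⊎ IsStar G))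
  Δ+χ[ω∸1]≤[n+1][ω∸1] {0} _ _ ()
  Δ+χ[ω∸1]≤[n+1][ω∸1] {1} _ _ (s≤s ())
  Δ+χ[ω∸1]≤[n+1][ω∸1] {2} {χ} isω isχ _ =
    bound , mk⇔ (inj₂ ∘ proj₂ ω≡2-case ∘ from-units) (≤-antisym bound ∘ [ complete-case , star-case ]′)
    where
    ω≡2-case = Δ+χ≤n+1-of-ω≡2 isω isχ
    units : ∀ {R : ℕ → ℕ → Set} → R (maxDegree G + χ) (n + 1) → R (maxDegree G + χ * 1) ((n + 1) * 1)
    units {R} = subst₂ R (cong (maxDegree G +_) (sym (*-identityʳ χ))) (sym (*-identityʳ (n + 1)))
    from-units : maxDegree G + χ * 1 ≡ (n + 1) * 1 → maxDegree G + χ ≡ n + 1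
    from-units = subst₂ _≡_ (cong (maxDegree G +_) (*-identityʳ χ)) (*-identityʳ (n + 1))
    bound : maxDegree G + χ * 1 ≤ (n + 1) * 1
    bound = units {R = _≤_} (proj₁ ω≡2-case)
    complete-case : IsComplete G → (n + 1) * 1 ≤ maxDegree G + χ * 1
    complete-case complete = [n+1]m≤Δ+χm-of-complete complete isω isχ
    star-case : IsStar G → (n + 1) * 1 ≤ maxDegree G + χ * 1
    star-case star = units {R = λ a b → b ≤ a} ([n+1]≤Δ+χ-of-star star isω isχ)
  Δ+χ[ω∸1]≤[n+1][ω∸1] {suc (suc (suc q))} {χ} isω isχ _ =
    proj₁ ω≥3-case ,
    mk⇔ (inj₁ ∘ proj₂ ω≥3-case) (≤-antisym (proj₁ ω≥3-case) ∘ [ complete-case , star-case ]′)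
    where
    ω≥3-case = Δ+χ[ω∸1]≤[n+1][ω∸1]-of-ω≥3 isω isχ
    complete-case : IsComplete G → (n + 1) * (2 + q) ≤ maxDegree G + χ * (2 + q)
    complete-case complete = [n+1]m≤Δ+χm-of-complete complete isω isχ
    star-case : IsStar G → (n + 1) * (2 + q) ≤ maxDegree G + χ * (2 + q)
    star-case star = contradiction (star⇒ω≤2 star isω) λ { (s≤s (s≤s ())) }

proposition9 : ∀ {n} (G : Graph n) (ω χ α : ℕ) →
    IsCliqueNumber G ω → IsChromaticNumber G χ → IsIndependenceNumber G α →
    (2 ≤ ω →
      (maxDegree G + χ * (ω ∸ 1) ≤ (n + 1) * (ω ∸ 1))
      × ((maxDegree G + χ * (ω ∸ 1) ≡ (n + 1) * (ω ∸ 1)) ⇔ (IsComplete G ⊎ IsStar G)))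
    × ((α + χ ≤ n + 1)
      × ((α + χ ≡ n + 1) ⇔ (∃ λ (v : Fin n) → NeighbourhoodComplete G v × ComplementOfNeighbourhoodIndependent G v)))
proposition9 G ω χ α isω isχ isα =
  Δ+χ[ω∸1]≤[n+1][ω∸1] G isω isχ , α+χ≤n+1-with-equality G isα isχ
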